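{- Let $m>2$ and let $\mathsf{Star}_m$ be the star on $m$ vertices with a multiplicity list $c\in\mathbb{Z}_{>0}^m$ in which the center has multiplicity $k\geq 2$, with total multiplicity $n$. Then $\mathsf{FS}_m(\mathsf{Cycle}_n,\mathsf{Star}_m)$ is connected if and only if $m=3$ and one of the two leaves of $\mathsf{Star}_3$ has multiplicity $1$.
   Context: $\mathsf{Cycle}_n$ is the cycle graph on $n$ vertices. For a simple graph $X$ on $n$ vertices and a graph $Y$ with multiplicities $c_y\in\mathbb{Z}_{>0}$ summing to $n$, $\mathsf{FS}_m(X,Y)$ has as vertices the functions $\sigma:V(X)\to V(Y)$ with $|\sigma^{ -1}(y)|=c_y$ for all $y$, with $\sigma,\tau$ adjacent if $\sigma=\tau\circ(a\ b)$ for some $ab\in E(X)$ with $\sigma(a)\sigma(b)\in E(Y)$. -}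

module Defs where

open import Data.Nat using (ℕ; zero; suc; _+_)
open import Data.Fin using (Fin; zero; suc; toℕ; _≟_)
open import Data.List using (List; length; filter)
open import Data.List.Base using ()
open import Data.Fin.Base using ()
open import Data.Product using (Σ; _×_; proj₁)
open import Data.Sum using (_⊎_)
open import Relation.Nullary using (¬_)
open import Relation.Binary.PropositionalEquality using (_≡_; _≢_)
open import Relation.Binary.Construct.Closure.ReflexiveTransitive using (Star)
open import Data.List using (allFin)

sumFin : ∀ {m} → (Fin m → ℕ) → ℕ
sumFin {zero} f = 0
sumFin {suc m} f = f zero + sumFin (λ i → f (suc i))

Graph : ℕ → Set₁
Graph k = Fin k → Fin k → Set

CycleAdj : (n : ℕ) → Graph n
CycleAdj n i j =
  (suc (toℕ i) ≡ toℕ j) ⊎ (suc (toℕ j) ≡ toℕ i)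
  ⊎ ((toℕ i ≡ 0) × (suc (toℕ j) ≡ n)) ⊎ ((toℕ j ≡ 0) × (suc (toℕ i) ≡ n))

StarAdj : (m : ℕ) → Fin m → Graph m
StarAdj m ctr x y = ((x ≡ ctr) × (y ≢ ctr)) ⊎ ((y ≡ ctr) × (x ≢ ctr))

swap : ∀ {n} → Fin n → Fin n → Fin n → Fin n
swap a b i with i ≟ a
... | Relation.Nullary.yes _ = b
... | Relation.Nullary.no _ with i ≟ b
...   | Relation.Nullary.yes _ = a
...   | Relation.Nullary.no _ = i

fiberSize : ∀ {n m} → (Fin n → Fin m) → Fin m → ℕ
fiberSize {n} σ y = length (filter (λ i → σ i ≟ y) (allFin n))

FSVertex : (n m : ℕ) → (Fin m → ℕ) → Set
FSVertex n m c = Σ (Fin n → Fin m) (λ σ → ∀ y → fiberSize σ y ≡ c y)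

FSAdj : ∀ {n m} (X : Graph n) (Y : Graph m) (c : Fin m → ℕ) →
        FSVertex n m c → FSVertex n m c → Set
FSAdj {n} X Y c σ τ =
  Σ (Fin n) λ a → Σ (Fin n) λ b →
    X a b × Y (proj₁ σ a) (proj₁ σ b) × (∀ i → proj₁ σ i ≡ proj₁ τ (swap a b i))

FSConnected : ∀ {n m} (X : Graph n) (Y : Graph m) (c : Fin m → ℕ) → Set
FSConnected {n} {m} X Y c = ∀ (σ τ : FSVertex n m c) → Star (FSAdj X Y c) σ τ

module Submission where

-- Encode a vertex σ by its word tabulate σ over the letters Fin m. A swap along an edge of the
-- cycle exchanges two cyclically adjacent letters one of which is the centre, so deleting all
-- centres from the word changes it at most by a rotation (when the swapped positions are the
-- last and the first). Hence, for two leaves u₁ ≠ u₂, the number of cyclic occurrences of u₂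
-- immediately followed by u₁ in the leaf word is invariant along paths. The words u₁ u₂ T C and
-- u₂ u₁ T C, with C the centres and T = u₂…u₂ R u₁…u₁ the remaining leaves, differ in this
-- number as soon as T neither starts with u₁ nor ends with u₂; this can be arranged whenever
-- there is a third leaf or both leaves have multiplicity at least 2.
-- Conversely, for Star₃ with a leaf ℓ of multiplicity 1 and other leaf b, bubbling the centres
-- to the end of a word and then rotating its leaf word (a centre at the end lets the first
-- letter travel around the cycle) reaches the single word ℓ b…b ctr…ctr.

open import Defs

open import Algebra.Properties.CommutativeSemigroup using (interchange)
open import Data.Bool using (if_then_else_)
open import Data.Empty using (⊥-elim)
open import Data.Fin
  using (Fin; zero; suc; toℕ; _≟_; fromℕ; inject₁; opposite; punchIn; punchOut)
open import Data.Fin.Properties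
  using ( fromℕ≢inject₁; toℕ-injective; toℕ-fromℕ; punchInᵢ≢i; punchIn-injective
        ; punchOut-injective; punchIn-punchOut )
  renaming (suc-injective to Fin-suc-injective)
open import Data.List
  using ( List; []; _∷_; _++_; _∷ʳ_; [_]; length; filter; map; concatMap; tabulate
        ; replicate; allFin; lookup )
open import Data.List.Properties
  using ( ++-assoc; ++-identityʳ; ∷-injective; ∷ʳ-injective; tabulate-lookup; tabulate-cong
        ; length-++; length-replicate; map-tabulate; filter-++; filter-accept; filter-reject
        ; filter-all; filter-none )
open import Data.List.Relation.Binary.Permutation.Propositional
  using (_↭_; ↭-refl; ↭-prep; ↭-swap; ↭-sym; ↭-trans)
open import Data.List.Relation.Binary.Permutation.Propositional.Properties
  using (↭-length; filter-↭; ∷↭∷ʳ)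
open import Data.List.Relation.Unary.All using (All; []; _∷_)
import Data.List.Relation.Unary.All as All
open import Data.List.Relation.Unary.All.Properties
  using (++⁺; ++⁻ˡ; ++⁻ʳ; replicate⁺; concat⁺; map⁺; all-filter)
open import Data.Nat using (ℕ; zero; suc; _+_; _*_; _<_; _≤_; s≤s) renaming (_≟_ to _≟ℕ_)
open import Data.Nat.Properties
  using ( +-commutativeSemigroup; +-comm; +-assoc; +-identityʳ; *-zeroʳ; *-suc; *-identityʳ
        ; 1+n≢n; ≤∧≢⇒<; m≤n⇒∃[o]m+o≡n )
  renaming (suc-injective to ℕ-suc-injective)
open import Data.Product using (Σ; _×_; _,_; proj₁; proj₂)
open import Data.Sum using (inj₁; inj₂)
open import Function using (_∘_; id)
open import Function.Bundles using (_⇔_; mk⇔)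
open import Relation.Binary.Construct.Closure.ReflexiveTransitive
  using (Star; ε; _◅_; _◅◅_; gmap; reverse)
open import Relation.Binary.Construct.Closure.ReflexiveTransitive.Properties
  using (module StarReasoning)
open import Relation.Binary.Definitions using (Decidable)
open import Relation.Binary.PropositionalEquality
  using (_≡_; _≢_; refl; sym; trans; cong; cong₂; subst; subst₂; module ≡-Reasoning)
open import Relation.Nullary using (¬_; ¬?; Dec; yes; no; does; contradiction)
open import Relation.Nullary.Decidable using (dec-true; dec-false; _×-dec_)

private
  variable
    m n : ℕ

swap-first : (a b : Fin n) → swap a b a ≡ b
swap-first a b with a ≟ a
... | yes _ = refl
... | no a≢a = contradiction refl a≢a

swap-second : (a b : Fin n) → swap a b b ≡ a
swap-second a b with b ≟ a
... | yes b≡a = b≡a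
... | no _ with b ≟ b
...   | yes _ = refl
...   | no b≢b = contradiction refl b≢b

swap-other : {a b i : Fin n} → i ≢ a → i ≢ b → swap a b i ≡ i
swap-other {a = a} {b} {i} i≢a i≢b with i ≟ a
... | yes i≡a = contradiction i≡a i≢a
... | no _ with i ≟ b
...   | yes i≡b = contradiction i≡b i≢b
...   | no _ = refl

swap-involutive : (a b i : Fin n) → swap a b (swap a b i) ≡ i
swap-involutive a b i with i ≟ a
... | yes refl = swap-second i b
... | no i≢a with i ≟ b
...   | yes refl = swap-first a i
...   | no i≢b = swap-other i≢a i≢b

swap-comm : (a b i : Fin n) → swap a b i ≡ swap b a i
swap-comm a b i = by-cases (i ≟ a) (i ≟ b)
  where
  by-cases : Dec (i ≡ a) → Dec (i ≡ b) → swap a b i ≡ swap b a i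
  by-cases (yes refl) _ = trans (swap-first i b) (sym (swap-second b i))
  by-cases (no _) (yes refl) = trans (swap-second a i) (sym (swap-first i a))
  by-cases (no i≢a) (no i≢b) = trans (swap-other i≢a i≢b) (sym (swap-other i≢b i≢a))

swap-suc : (a b i : Fin n) → swap (suc a) (suc b) (suc i) ≡ suc (swap a b i)
swap-suc a b i with i ≟ a
... | yes _ = refl
... | no _ with i ≟ b
...   | yes _ = refl
...   | no _ = refl

count : Fin m → List (Fin m) → ℕ
count y = length ∘ filter (_≟ y)

module _ {y : Fin m} where

  count-∷-≡ : (xs : List (Fin m)) → count y (y ∷ xs) ≡ suc (count y xs)
  count-∷-≡ xs = cong length (filter-accept (_≟ y) refl)

  count-∷-≢ : {x : Fin m} (xs : List (Fin m)) → x ≢ y → count y (x ∷ xs) ≡ count y xs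
  count-∷-≢ xs x≢y = cong length (filter-reject (_≟ y) x≢y)

  count-++ : (xs ys : List (Fin m)) → count y (xs ++ ys) ≡ count y xs + count y ys
  count-++ xs ys = trans (cong length (filter-++ (_≟ y) xs ys)) (length-++ (filter (_≟ y) xs))

  count-replicate-≡ : (k : ℕ) → count y (replicate k y) ≡ k
  count-replicate-≡ k =
    trans (cong length (filter-all (_≟ y) (replicate⁺ k refl))) (length-replicate k)

  count-none : {xs : List (Fin m)} → All (_≢ y) xs → count y xs ≡ 0
  count-none none = cong length (filter-none (_≟ y) none)

  count-replicate-≢ : {x : Fin m} (k : ℕ) → x ≢ y → count y (replicate k x) ≡ 0
  count-replicate-≢ k x≢y = count-none (replicate⁺ k x≢y)

  count≡0⇒none : (xs : List (Fin m)) → count y xs ≡ 0 → All (_≢ y) xs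
  count≡0⇒none [] _ = []
  count≡0⇒none (x ∷ xs) eq with x ≟ y
  ... | no x≢y = x≢y ∷ count≡0⇒none xs eq

  count≡1⇒split : (xs : List (Fin m)) → count y xs ≡ 1 →
    Σ (List (Fin m)) λ us → Σ (List (Fin m)) λ vs →
      xs ≡ us ++ y ∷ vs × All (_≢ y) us × All (_≢ y) vs
  count≡1⇒split (x ∷ xs) eq with x ≟ y
  ... | yes refl = [] , xs , refl , [] , count≡0⇒none xs (ℕ-suc-injective eq)
  ... | no x≢y with count≡1⇒split xs eq
  ...   | us , vs , refl , us-none , vs-none = x ∷ us , vs , refl , x≢y ∷ us-none , vs-none

count-↭ : (y : Fin m) {xs ys : List (Fin m)} → xs ↭ ys → count y xs ≡ count y ys
count-↭ y p = ↭-length (filter-↭ (_≟ y) p)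

count-map : {A : Set} (f : A → Fin m) (y : Fin m) (xs : List A) →
  count y (map f xs) ≡ length (filter (λ x → f x ≟ y) xs)
count-map f y [] = refl
count-map f y (x ∷ xs) with f x ≟ y
... | yes _ = cong suc (count-map f y xs)
... | no _ = count-map f y xs

count-map-suc : (y : Fin m) (xs : List (Fin m)) → count (suc y) (map suc xs) ≡ count y xs
count-map-suc y [] = refl
count-map-suc y (x ∷ xs) with x ≟ y
... | yes _ = cong suc (count-map-suc y xs)
... | no _ = count-map-suc y xs

count-zero-map-suc : (xs : List (Fin m)) → count zero (map suc xs) ≡ 0
count-zero-map-suc [] = refl
count-zero-map-suc (x ∷ xs) = count-zero-map-suc xs

allFin-suc : (m : ℕ) → allFin (suc m) ≡ zero ∷ map suc (allFin m)
allFin-suc m = cong (zero ∷_) (sym (map-tabulate id suc))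

count-allFin : (y : Fin m) → count y (allFin m) ≡ 1
count-allFin {suc m} zero =
  trans (cong (count zero) (allFin-suc m)) (cong suc (count-zero-map-suc (allFin m)))
count-allFin {suc m} (suc y) =
  trans (cong (count (suc y)) (allFin-suc m)) (trans (count-map-suc y (allFin m)) (count-allFin y))

count-filter : {P : Fin m → Set} (P? : ∀ x → Dec (P x)) {y : Fin m} → P y → (xs : List (Fin m)) →
  count y (filter P? xs) ≡ count y xs
count-filter P? py [] = refl
count-filter {P = P} P? {y} py (x ∷ xs) with P? x
... | yes _ = trans (count-++ [ x ] _)
                (trans (cong (count y [ x ] +_) (count-filter P? py xs)) (sym (count-++ [ x ] xs)))
... | no ¬px =
  trans (count-filter P? py xs) (sym (count-∷-≢ {x = x} xs λ x≡y → ¬px (subst P (sym x≡y) py)))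

blocks : (Fin m → ℕ) → List (Fin m) → List (Fin m)
blocks c = concatMap (λ z → replicate (c z) z)

count-blocks : (c : Fin m → ℕ) (y : Fin m) (zs : List (Fin m)) →
  count y (blocks c zs) ≡ c y * count y zs
count-blocks c y [] = sym (*-zeroʳ (c y))
count-blocks c y (z ∷ zs) with z ≟ y
... | yes refl = trans (count-++ (replicate (c z) z) _)
                   (trans (cong₂ _+_ (count-replicate-≡ (c z)) (count-blocks c z zs))
                          (sym (*-suc (c z) _)))
... | no z≢y = trans (count-++ (replicate (c z) z) _)
                 (cong₂ _+_ (count-replicate-≢ (c z) z≢y) (count-blocks c y zs))

blocks-All : {P : Fin m → Set} (c : Fin m → ℕ) {zs : List (Fin m)} → All P zs → All P (blocks c zs)
blocks-All c pzs = concat⁺ (map⁺ (All.map (replicate⁺ _) pzs))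

All≡⇒replicate : {b : Fin m} {xs : List (Fin m)} → All (_≡ b) xs → xs ≡ replicate (count b xs) b
All≡⇒replicate [] = refl
All≡⇒replicate {xs = x ∷ xs} (refl ∷ xs≡b) =
  trans (cong (x ∷_) (All≡⇒replicate xs≡b)) (cong (λ k → replicate k x) (sym (count-∷-≡ xs)))

replicate-∷ʳ : {A : Set} (k : ℕ) (x : A) → replicate (suc k) x ≡ replicate k x ++ [ x ]
replicate-∷ʳ zero x = refl
replicate-∷ʳ (suc k) x = cong (x ∷_) (replicate-∷ʳ k x)

sumFin-cong : {f g : Fin m → ℕ} → (∀ y → f y ≡ g y) → sumFin f ≡ sumFin g
sumFin-cong {zero} f≗g = refl
sumFin-cong {suc m} f≗g = cong₂ _+_ (f≗g zero) (sumFin-cong (f≗g ∘ suc))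

sumFin-+ : (f g : Fin m → ℕ) → sumFin (λ y → f y + g y) ≡ sumFin f + sumFin g
sumFin-+ {zero} f g = refl
sumFin-+ {suc m} f g = trans (cong (f zero + g zero +_) (sumFin-+ (f ∘ suc) (g ∘ suc)))
                             (interchange +-commutativeSemigroup (f zero) (g zero) _ _)

sumFin-zero : sumFin {m} (λ _ → 0) ≡ 0
sumFin-zero {zero} = refl
sumFin-zero {suc m} = sumFin-zero {m}

sumFin-count-singleton : (x : Fin m) → sumFin (λ y → count y [ x ]) ≡ 1
sumFin-count-singleton {suc m} zero = cong suc (sumFin-zero {m})
sumFin-count-singleton {suc m} (suc x) = trans (sumFin-cong count-suc) (sumFin-count-singleton x)
  where
  count-suc : ∀ y → count (suc y) [ suc x ] ≡ count y [ x ]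
  count-suc y with x ≟ y
  ... | yes _ = refl
  ... | no _ = refl

length≡sumFin-count : (xs : List (Fin m)) → length xs ≡ sumFin (λ y → count y xs)
length≡sumFin-count {m} [] = sym (sumFin-zero {m})
length≡sumFin-count (x ∷ xs) = begin
  suc (length xs)
    ≡⟨ cong₂ _+_ (sym (sumFin-count-singleton x)) (length≡sumFin-count xs) ⟩
  sumFin (λ y → count y [ x ]) + sumFin (λ y → count y xs)
    ≡⟨ sym (sumFin-+ (λ y → count y [ x ]) (λ y → count y xs)) ⟩
  sumFin (λ y → count y [ x ] + count y xs)
    ≡⟨ sumFin-cong (λ y → sym (count-++ {y = y} [ x ] xs)) ⟩
  sumFin (λ y → count y (x ∷ xs)) ∎
  where open ≡-Reasoning

HasCounts : (Fin m → ℕ) → List (Fin m) → Set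
HasCounts c xs = ∀ y → count y xs ≡ c y

fiberSize≡count : (σ : Fin n → Fin m) (y : Fin m) → fiberSize σ y ≡ count y (tabulate σ)
fiberSize≡count {n} σ y =
  sym (trans (cong (count y) (sym (map-tabulate id σ))) (count-map σ y (allFin n)))

vertex : {c : Fin m → ℕ} (f : Fin n → Fin m) → HasCounts c (tabulate f) → FSVertex n m c
vertex f counts = f , λ y → trans (fiberSize≡count f y) (counts y)

vertex-counts : {c : Fin m → ℕ} (σ : FSVertex n m c) → HasCounts c (tabulate (proj₁ σ))
vertex-counts (σ , fibers) y = trans (sym (fiberSize≡count σ y)) (fibers y)

list-vertex : {c : Fin m → ℕ} (xs : List (Fin m)) → length xs ≡ n → HasCounts c xs →
  Σ (FSVertex n m c) λ σ → tabulate (proj₁ σ) ≡ xs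
list-vertex xs refl counts =
  vertex (lookup xs) (λ y → trans (cong (count y) (tabulate-lookup xs)) (counts y)) , tabulate-lookup xs

list-vertex-sumFin : {c : Fin m → ℕ} (xs : List (Fin m)) → HasCounts c xs →
  Σ (FSVertex (sumFin c) m c) λ σ → tabulate (proj₁ σ) ≡ xs
list-vertex-sumFin xs counts =
  list-vertex xs (trans (length≡sumFin-count xs) (sumFin-cong counts)) counts

tabulate-injective : {A : Set} {f g : Fin n → A} → tabulate f ≡ tabulate g → ∀ i → f i ≡ g i
tabulate-injective {suc n} eq zero = proj₁ (∷-injective eq)
tabulate-injective {suc n} eq (suc i) = tabulate-injective (proj₂ (∷-injective eq)) i

tabulate-∷ʳ : {A : Set} (h : Fin (suc n) → A) →
  tabulate h ≡ tabulate (h ∘ inject₁) ∷ʳ h (fromℕ n)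
tabulate-∷ʳ {zero} h = refl
tabulate-∷ʳ {suc n} h = cong (h zero ∷_) (tabulate-∷ʳ (λ i → h (suc i)))

module _ {A : Set} {n : ℕ} where

  private
    last : Fin (suc (suc n))
    last = fromℕ (suc n)

    inner : (Fin (suc (suc n)) → A) → List A
    inner h = tabulate (λ i → h (suc (inject₁ i)))

  tabulate-ends : (h : Fin (suc (suc n)) → A) → tabulate h ≡ h zero ∷ inner h ++ [ h last ]
  tabulate-ends h = cong (h zero ∷_) (tabulate-∷ʳ (λ i → h (suc i)))

  tabulate-swap-ends : (f g : Fin (suc (suc n)) → A) → (∀ i → f i ≡ g (swap zero last i)) →
    tabulate g ≡ f last ∷ inner f ++ [ f zero ]
  tabulate-swap-ends f g f≗g∘swap = trans (tabulate-ends g)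
    (trans (cong₂ (λ u v → u ∷ v ++ [ g last ]) g-zero (tabulate-cong g-inner))
           (cong (λ u → f last ∷ inner f ++ [ u ]) g-last))
    where
    g-zero : g zero ≡ f last
    g-zero = trans (cong g (sym (swap-second zero last))) (sym (f≗g∘swap last))
    g-last : g last ≡ f zero
    g-last = trans (cong g (sym (swap-first zero last))) (sym (f≗g∘swap zero))
    g-inner : ∀ i → g (suc (inject₁ i)) ≡ f (suc (inject₁ i))
    g-inner i =
      trans (cong g (sym (swap-other {a = zero} (λ ()) (fromℕ≢inject₁ ∘ sym ∘ Fin-suc-injective))))
            (sym (f≗g∘swap (suc (inject₁ i))))

module _ {ctr : Fin m} where

  StarAdj-sym : {x y : Fin m} → StarAdj m ctr x y → StarAdj m ctr y x
  StarAdj-sym (inj₁ x-centre) = inj₂ x-centre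
  StarAdj-sym (inj₂ y-centre) = inj₁ y-centre

  StarAdj-irrefl : {x : Fin m} → ¬ StarAdj m ctr x x
  StarAdj-irrefl (inj₁ (x≡ctr , x≢ctr)) = x≢ctr x≡ctr
  StarAdj-irrefl (inj₂ (x≡ctr , x≢ctr)) = x≢ctr x≡ctr

data LinearMove (ctr : Fin m) : List (Fin m) → List (Fin m) → Set where
  here  : {x y : Fin m} {zs : List (Fin m)} → StarAdj m ctr x y →
          LinearMove ctr (x ∷ y ∷ zs) (y ∷ x ∷ zs)
  there : {z : Fin m} {xs ys : List (Fin m)} → LinearMove ctr xs ys →
          LinearMove ctr (z ∷ xs) (z ∷ ys)

data CyclicMove (ctr : Fin m) : List (Fin m) → List (Fin m) → Set where
  linear : {xs ys : List (Fin m)} → LinearMove ctr xs ys → CyclicMove ctr xs ys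
  wrap   : {x y : Fin m} {zs : List (Fin m)} → StarAdj m ctr x y →
           CyclicMove ctr (x ∷ zs ++ [ y ]) (y ∷ zs ++ [ x ])

module _ {ctr : Fin m} where

  LinearMove-sym : {xs ys : List (Fin m)} → LinearMove ctr xs ys → LinearMove ctr ys xs
  LinearMove-sym (here adj) = here (StarAdj-sym adj)
  LinearMove-sym (there mv) = there (LinearMove-sym mv)

  CyclicMove-sym : {xs ys : List (Fin m)} → CyclicMove ctr xs ys → CyclicMove ctr ys xs
  CyclicMove-sym (linear mv) = linear (LinearMove-sym mv)
  CyclicMove-sym (wrap adj) = wrap (StarAdj-sym adj)

  LinearMove⇒↭ : {xs ys : List (Fin m)} → LinearMove ctr xs ys → xs ↭ ys
  LinearMove⇒↭ (here {x} {y} _) = ↭-swap x y ↭-refl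
  LinearMove⇒↭ (there {z} mv) = ↭-prep z (LinearMove⇒↭ mv)

  CyclicMove⇒↭ : {xs ys : List (Fin m)} → CyclicMove ctr xs ys → xs ↭ ys
  CyclicMove⇒↭ (linear mv) = LinearMove⇒↭ mv
  CyclicMove⇒↭ (wrap {x} {y} {zs} _) =
    ↭-trans (↭-prep x (↭-sym (∷↭∷ʳ y zs)))
            (↭-trans (↭-swap x y ↭-refl) (↭-prep y (∷↭∷ʳ x zs)))

  move-preserves-counts : {c : Fin m → ℕ} {xs ys : List (Fin m)} →
    CyclicMove ctr xs ys → HasCounts c xs → HasCounts c ys
  move-preserves-counts mv counts y = trans (sym (count-↭ y (CyclicMove⇒↭ mv))) (counts y)

  moves-preserve-counts : {c : Fin m → ℕ} {xs ys : List (Fin m)} →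
    Star (CyclicMove ctr) xs ys → HasCounts c xs → HasCounts c ys
  moves-preserve-counts ε counts = counts
  moves-preserve-counts (mv ◅ mvs) counts = moves-preserve-counts mvs (move-preserves-counts mv counts)

-- Moves are the edges of the friends-and-strangers graph

SwapStep : Graph n → Fin m → (Fin n → Fin m) → (Fin n → Fin m) → Set
SwapStep {n} {m} X ctr f g = Σ (Fin n) λ a → Σ (Fin n) λ b →
  X a b × StarAdj m ctr (f a) (f b) × (∀ i → f i ≡ g (swap a b i))

-- CycleAdj n a b unfolds to PathAdj n a b ⊎ PathAdj n b a ⊎ WrapAdj n a b ⊎ WrapAdj n b a.
PathAdj : (n : ℕ) → Graph n
PathAdj n a b = suc (toℕ a) ≡ toℕ b

WrapAdj : (n : ℕ) → Graph n
WrapAdj n a b = (toℕ a ≡ 0) × (suc (toℕ b) ≡ n)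

module _ {ctr : Fin m} where

  flipped : {X : Graph n} {f g : Fin n → Fin m} (a b : Fin n) → X b a → StarAdj m ctr (f a) (f b) →
    (∀ i → f i ≡ g (swap a b i)) → SwapStep X ctr f g
  flipped {g = g} a b x adj f≗g∘swap =
    b , a , x , StarAdj-sym adj , λ i → trans (f≗g∘swap i) (cong g (swap-comm a b i))

  PathSwap⇒LinearMove : {f g : Fin n → Fin m} → SwapStep (PathAdj n) ctr f g →
    LinearMove ctr (tabulate f) (tabulate g)
  PathSwap⇒LinearMove {f = f} {g} (zero , suc zero , _ , adj , f≗g∘swap) =
    subst (LinearMove ctr (tabulate f)) tabulate-g (here adj)
    where
    tabulate-g : f (suc zero) ∷ f zero ∷ tabulate (λ i → f (suc (suc i))) ≡ tabulate g
    tabulate-g = cong₂ _∷_ (f≗g∘swap (suc zero))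
                   (cong₂ _∷_ (f≗g∘swap zero) (tabulate-cong (λ i → f≗g∘swap (suc (suc i)))))
  PathSwap⇒LinearMove {f = f} {g} (suc a , suc b , a+1≡b , adj , f≗g∘swap) =
    subst (λ z → LinearMove ctr (tabulate f) (z ∷ tabulate (λ i → g (suc i)))) (f≗g∘swap zero)
      (there (PathSwap⇒LinearMove (a , b , ℕ-suc-injective a+1≡b , adj ,
        λ i → trans (f≗g∘swap (suc i)) (cong g (swap-suc a b i)))))

  LinearMove⇒PathSwap : (f : Fin n → Fin m) {ys : List (Fin m)} → LinearMove ctr (tabulate f) ys →
    Σ (Fin n → Fin m) λ g → tabulate g ≡ ys × SwapStep (PathAdj n) ctr f g
  LinearMove⇒PathSwap {suc (suc k)} f (here adj) =
    g , refl , zero , suc zero , refl , adj , f≗g∘swap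
    where
    g : Fin (suc (suc k)) → Fin m
    g zero = f (suc zero)
    g (suc zero) = f zero
    g (suc (suc i)) = f (suc (suc i))
    f≗g∘swap : ∀ i → f i ≡ g (swap zero (suc zero) i)
    f≗g∘swap zero = refl
    f≗g∘swap (suc zero) = refl
    f≗g∘swap (suc (suc i)) = refl
  LinearMove⇒PathSwap {suc k} f (there mv) with LinearMove⇒PathSwap (λ i → f (suc i)) mv
  ... | g , refl , a , b , a+1≡b , adj , f≗g∘swap =
    g′ , refl , suc a , suc b , cong suc a+1≡b , adj , f≗g′∘swap
    where
    g′ : Fin (suc k) → Fin m
    g′ zero = f zero
    g′ (suc i) = g i
    f≗g′∘swap : ∀ i → f i ≡ g′ (swap (suc a) (suc b) i)
    f≗g′∘swap zero = refl
    f≗g′∘swap (suc i) = trans (f≗g∘swap i) (cong g′ (sym (swap-suc a b i)))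

  WrapSwap⇒CyclicMove : {f g : Fin n → Fin m} → SwapStep (WrapAdj n) ctr f g →
    CyclicMove ctr (tabulate f) (tabulate g)
  WrapSwap⇒CyclicMove {suc zero} (zero , zero , _ , adj , _) = ⊥-elim (StarAdj-irrefl adj)
  WrapSwap⇒CyclicMove {suc (suc n)} {f} {g} (zero , b , (_ , b-last) , adj , f≗g∘swap)
    with toℕ-injective {i = b} {j = fromℕ (suc n)}
           (trans (ℕ-suc-injective b-last) (sym (toℕ-fromℕ (suc n))))
  ... | refl = subst₂ (CyclicMove ctr) (sym (tabulate-ends f)) (sym (tabulate-swap-ends f g f≗g∘swap))
                 (wrap adj)

  wrap⇒WrapSwap : (f : Fin n → Fin m) {x y : Fin m} {zs : List (Fin m)} →
    tabulate f ≡ x ∷ zs ++ [ y ] → StarAdj m ctr x y →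
    Σ (Fin n → Fin m) λ g → tabulate g ≡ y ∷ zs ++ [ x ] × SwapStep (WrapAdj n) ctr f g
  wrap⇒WrapSwap {suc zero} f {zs = []} ()
  wrap⇒WrapSwap {suc zero} f {zs = _ ∷ _} ()
  wrap⇒WrapSwap {suc (suc n)} f {x} {y} {zs} tabulate-f adj =
    g , tabulate-g , zero , fromℕ (suc n) , (refl , cong suc (toℕ-fromℕ (suc n))) , adj′ , f≗g∘swap
    where
    g : Fin (suc (suc n)) → Fin m
    g = f ∘ swap zero (fromℕ (suc n))
    f≗g∘swap : ∀ i → f i ≡ g (swap zero (fromℕ (suc n)) i)
    f≗g∘swap i = cong f (sym (swap-involutive zero (fromℕ (suc n)) i))
    ends : f zero ≡ x × tabulate (λ i → f (suc (inject₁ i))) ++ [ f (fromℕ (suc n)) ] ≡ zs ++ [ y ]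
    ends = ∷-injective (trans (sym (tabulate-ends f)) tabulate-f)
    inner-last = ∷ʳ-injective _ zs (proj₂ ends)
    adj′ : StarAdj m ctr (f zero) (f (fromℕ (suc n)))
    adj′ = subst₂ (StarAdj m ctr) (sym (proj₁ ends)) (sym (proj₂ inner-last)) adj
    tabulate-g : tabulate g ≡ y ∷ zs ++ [ x ]
    tabulate-g = trans (tabulate-swap-ends f g f≗g∘swap)
      (cong₂ _∷_ (proj₂ inner-last) (cong₂ _++_ (proj₁ inner-last) (cong [_] (proj₁ ends))))

  SwapStep⇒CyclicMove : {f g : Fin n → Fin m} → SwapStep (CycleAdj n) ctr f g →
    CyclicMove ctr (tabulate f) (tabulate g)
  SwapStep⇒CyclicMove (a , b , inj₁ a→b , adj , f≗g∘swap) =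
    linear (PathSwap⇒LinearMove (a , b , a→b , adj , f≗g∘swap))
  SwapStep⇒CyclicMove {g = g} (a , b , inj₂ (inj₁ b→a) , adj , f≗g∘swap) =
    linear (PathSwap⇒LinearMove (flipped {g = g} a b b→a adj f≗g∘swap))
  SwapStep⇒CyclicMove (a , b , inj₂ (inj₂ (inj₁ a↺b)) , adj , f≗g∘swap) =
    WrapSwap⇒CyclicMove (a , b , a↺b , adj , f≗g∘swap)
  SwapStep⇒CyclicMove {g = g} (a , b , inj₂ (inj₂ (inj₂ b↺a)) , adj , f≗g∘swap) =
    WrapSwap⇒CyclicMove (flipped {g = g} a b b↺a adj f≗g∘swap)

  CyclicMove⇒SwapStep : (f : Fin n → Fin m) {xs ys : List (Fin m)} →
    CyclicMove ctr xs ys → tabulate f ≡ xs →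
    Σ (Fin n → Fin m) λ g → tabulate g ≡ ys × SwapStep (CycleAdj n) ctr f g
  CyclicMove⇒SwapStep f (linear mv) refl with LinearMove⇒PathSwap f mv
  ... | g , tabulate-g , a , b , a→b , step = g , tabulate-g , a , b , inj₁ a→b , step
  CyclicMove⇒SwapStep f (wrap adj) tabulate-f with wrap⇒WrapSwap f tabulate-f adj
  ... | g , tabulate-g , a , b , a↺b , step = g , tabulate-g , a , b , inj₂ (inj₂ (inj₁ a↺b)) , step

module _ {ctr : Fin m} {c : Fin m → ℕ} where

  private
    _∼_ : FSVertex n m c → FSVertex n m c → Set
    _∼_ {n} = FSAdj (CycleAdj n) (StarAdj m ctr) c

  lift-move : (σ : FSVertex n m c) {xs ys : List (Fin m)} → tabulate (proj₁ σ) ≡ xs →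
    CyclicMove ctr xs ys → Σ (FSVertex n m c) λ ρ → tabulate (proj₁ ρ) ≡ ys × σ ∼ ρ
  lift-move σ refl mv with CyclicMove⇒SwapStep (proj₁ σ) mv refl
  ... | g , refl , step = vertex g (move-preserves-counts mv (vertex-counts σ)) , refl , step

  lift-moves : (σ : FSVertex n m c) {xs ys : List (Fin m)} → tabulate (proj₁ σ) ≡ xs →
    Star (CyclicMove ctr) xs ys → Σ (FSVertex n m c) λ ρ → tabulate (proj₁ ρ) ≡ ys × Star _∼_ σ ρ
  lift-moves σ tabulate-σ ε = σ , tabulate-σ , ε
  lift-moves σ tabulate-σ (mv ◅ mvs) with lift-move σ tabulate-σ mv
  ... | ρ , tabulate-ρ , step with lift-moves ρ tabulate-ρ mvs
  ...   | ρ′ , tabulate-ρ′ , path = ρ′ , tabulate-ρ′ , step ◅ path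

  lift-moves-to : (σ τ : FSVertex n m c) {xs ys : List (Fin m)} → tabulate (proj₁ σ) ≡ xs →
    CyclicMove ctr xs ys → Star (CyclicMove ctr) ys (tabulate (proj₁ τ)) → Star _∼_ σ τ
  lift-moves-to σ τ tabulate-σ mv ε with CyclicMove⇒SwapStep (proj₁ σ) mv tabulate-σ
  ... | g , g≡τ , a , b , a~b , adj , σ≗g∘swap =
    (a , b , a~b , adj , λ i → trans (σ≗g∘swap i) (tabulate-injective g≡τ (swap a b i))) ◅ ε
  lift-moves-to σ τ tabulate-σ mv (mv′ ◅ mvs) with lift-move σ tabulate-σ mv
  ... | ρ , tabulate-ρ , step = step ◅ lift-moves-to ρ τ tabulate-ρ mv′ mvs

-- A vertex is only determined by its word up to pointwise equality, so a lifted path can end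
-- exactly at τ only through a last step; the detour N ⟶ N′ ⟶ N provides one.
common-word⇒connected : {ctr : Fin m} {c : Fin m → ℕ} {N N′ : List (Fin m)} → CyclicMove ctr N N′ →
  (∀ (σ : FSVertex n m c) → Star (CyclicMove ctr) (tabulate (proj₁ σ)) N) →
  FSConnected (CycleAdj n) (StarAdj m ctr) c
common-word⇒connected mv reaches σ τ with lift-moves σ refl (reaches σ)
... | ρ , tabulate-ρ , σ⇝ρ =
  σ⇝ρ ◅◅ lift-moves-to ρ τ tabulate-ρ mv (CyclicMove-sym mv ◅ reverse CyclicMove-sym (reaches τ))

-- The leaf-word invariant

final : {A : Set} → A → List A → A
final x [] = x
final x (y ∷ ys) = final y ys

module _ {A : Set} where

  final-++-∷ : (x : A) (xs : List A) (y : A) (ys : List A) → final x (xs ++ y ∷ ys) ≡ final y ys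
  final-++-∷ x [] y ys = refl
  final-++-∷ x (x′ ∷ xs) y ys = final-++-∷ x′ xs y ys

  final-All : {P : A → Set} {x : A} {xs : List A} → P x → All P xs → P (final x xs)
  final-All px [] = px
  final-All _ (px′ ∷ pxs) = final-All px′ pxs

module _ {A : Set} {R : A → A → Set} (R? : Decidable R) where

  link : A → A → ℕ
  link x y = if does (R? x y) then 1 else 0

  links : A → List A → ℕ
  links x [] = 0
  links x (y ∷ ys) = link x y + links y ys

  cyclicLinks : List A → ℕ
  cyclicLinks [] = 0
  cyclicLinks (x ∷ xs) = links x (xs ++ [ x ])

  link-related : (x y : A) → R x y → link x y ≡ 1
  link-related x y r = cong (λ b → if b then 1 else 0) (dec-true (R? x y) r)

  link-unrelated : (x y : A) → ¬ R x y → link x y ≡ 0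
  link-unrelated x y ¬r = cong (λ b → if b then 1 else 0) (dec-false (R? x y) ¬r)

  links-∷ʳ : (x : A) (xs : List A) (y : A) → links x (xs ++ [ y ]) ≡ links x xs + link (final x xs) y
  links-∷ʳ x [] y = +-identityʳ (link x y)
  links-∷ʳ x (x′ ∷ xs) y =
    trans (cong (link x x′ +_) (links-∷ʳ x′ xs y)) (sym (+-assoc (link x x′) _ _))

  cyclicLinks-rotate : (x : A) (xs : List A) → cyclicLinks (x ∷ xs) ≡ cyclicLinks (xs ++ [ x ])
  cyclicLinks-rotate x [] = refl
  cyclicLinks-rotate x (y ∷ ys) = begin
    link x y + links y (ys ++ [ x ])
      ≡⟨ +-comm (link x y) _ ⟩
    links y (ys ++ [ x ]) + link x y
      ≡⟨ cong (λ z → links y (ys ++ [ x ]) + link z y) (sym (final-++-∷ y ys x [])) ⟩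
    links y (ys ++ [ x ]) + link (final y (ys ++ [ x ])) y
      ≡⟨ sym (links-∷ʳ y (ys ++ [ x ]) y) ⟩
    links y ((ys ++ [ x ]) ++ [ y ]) ∎
    where open ≡-Reasoning

module _ {a b : Fin m} where

  Consecutive : Fin m → Fin m → Set
  Consecutive x y = x ≡ a × y ≡ b

  consecutive? : Decidable Consecutive
  consecutive? x y = (x ≟ a) ×-dec (y ≟ b)

  cyclicLinks-swap-front : a ≢ b → (t : Fin m) (ts : List (Fin m)) → t ≢ b → final t ts ≢ a →
    cyclicLinks consecutive? (a ∷ b ∷ t ∷ ts) ≡ suc (cyclicLinks consecutive? (b ∷ a ∷ t ∷ ts))
  cyclicLinks-swap-front a≢b t ts t≢b final≢a = begin
    link consecutive? a b + (link consecutive? b t + links consecutive? t (ts ++ [ a ]))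
      ≡⟨ cong₂ _+_ (link-related consecutive? a b (refl , refl))
                   (cong₂ _+_ (link-unrelated consecutive? b t (a≢b ∘ sym ∘ proj₁))
                              (closing-link a (a≢b ∘ proj₂))) ⟩
    1 + (0 + (links consecutive? t ts + 0))
      ≡⟨ cong suc (sym (cong₂ _+_ (link-unrelated consecutive? b a (a≢b ∘ sym ∘ proj₁))
                                  (cong₂ _+_ (link-unrelated consecutive? a t (t≢b ∘ proj₂))
                                             (closing-link b (final≢a ∘ proj₁))))) ⟩
    suc (link consecutive? b a + (link consecutive? a t + links consecutive? t (ts ++ [ b ]))) ∎
    where
    open ≡-Reasoning
    closing-link : (z : Fin m) → ¬ Consecutive (final t ts) z →
      links consecutive? t (ts ++ [ z ]) ≡ links consecutive? t ts + 0
    closing-link z ¬link = trans (links-∷ʳ consecutive? t ts z)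
      (cong (links consecutive? t ts +_) (link-unrelated consecutive? _ z ¬link))

leaves : Fin m → List (Fin m) → List (Fin m)
leaves ctr = filter (λ x → ¬? (x ≟ ctr))

module _ {ctr : Fin m} where

  leaves-centre : (xs : List (Fin m)) → leaves ctr (ctr ∷ xs) ≡ leaves ctr xs
  leaves-centre xs = filter-reject (λ x → ¬? (x ≟ ctr)) (λ ctr≢ctr → ctr≢ctr refl)

  leaves-leaf : {x : Fin m} (xs : List (Fin m)) → x ≢ ctr → leaves ctr (x ∷ xs) ≡ x ∷ leaves ctr xs
  leaves-leaf xs x≢ctr = filter-accept (λ x → ¬? (x ≟ ctr)) x≢ctr

  leaves-++ : (xs ys : List (Fin m)) → leaves ctr (xs ++ ys) ≡ leaves ctr xs ++ leaves ctr ys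
  leaves-++ = filter-++ (λ x → ¬? (x ≟ ctr))

  leaves-∷-cong : (z : Fin m) {xs ys : List (Fin m)} → leaves ctr xs ≡ leaves ctr ys →
    leaves ctr (z ∷ xs) ≡ leaves ctr (z ∷ ys)
  leaves-∷-cong z eq with z ≟ ctr
  ... | yes _ = eq
  ... | no _ = cong (z ∷_) eq

  leaves-++-centres : {xs : List (Fin m)} (k : ℕ) → All (_≢ ctr) xs →
    leaves ctr (xs ++ replicate k ctr) ≡ xs
  leaves-++-centres {xs} k xs-leaves = begin
    leaves ctr (xs ++ replicate k ctr)
      ≡⟨ leaves-++ xs _ ⟩
    leaves ctr xs ++ leaves ctr (replicate k ctr)
      ≡⟨ cong₂ _++_ (filter-all _ xs-leaves) (filter-none _ (replicate⁺ k λ ctr≢ctr → ctr≢ctr refl)) ⟩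
    xs ++ []
      ≡⟨ ++-identityʳ xs ⟩
    xs ∎
    where open ≡-Reasoning

  leaves-centre-leaf : {y : Fin m} (zs : List (Fin m)) → y ≢ ctr →
    leaves ctr (ctr ∷ y ∷ zs) ≡ leaves ctr (y ∷ ctr ∷ zs)
  leaves-centre-leaf zs y≢ctr = trans (trans (leaves-centre _) (leaves-leaf zs y≢ctr))
    (sym (trans (leaves-leaf _ y≢ctr) (cong (_ ∷_) (leaves-centre zs))))

  leaves-centre-∷-∷ʳ : {y : Fin m} (zs : List (Fin m)) → y ≢ ctr →
    leaves ctr (ctr ∷ zs ++ [ y ]) ≡ leaves ctr zs ++ [ y ]
  leaves-centre-∷-∷ʳ zs y≢ctr =
    trans (trans (leaves-centre _) (leaves-++ zs _)) (cong (leaves ctr zs ++_) (leaves-leaf [] y≢ctr))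

  leaves-∷-centre-∷ʳ : {y : Fin m} (zs : List (Fin m)) → y ≢ ctr →
    leaves ctr (y ∷ zs ++ [ ctr ]) ≡ y ∷ leaves ctr zs
  leaves-∷-centre-∷ʳ {y} zs y≢ctr = trans (leaves-leaf _ y≢ctr)
    (cong (y ∷_) (trans (leaves-++ zs _)
                        (trans (cong (leaves ctr zs ++_) (leaves-centre [])) (++-identityʳ _))))

  LinearMove⇒leaves≡ : {xs ys : List (Fin m)} → LinearMove ctr xs ys → leaves ctr xs ≡ leaves ctr ys
  LinearMove⇒leaves≡ (here {zs = zs} (inj₁ (refl , y≢ctr))) = leaves-centre-leaf zs y≢ctr
  LinearMove⇒leaves≡ (here {zs = zs} (inj₂ (refl , x≢ctr))) = sym (leaves-centre-leaf zs x≢ctr)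
  LinearMove⇒leaves≡ (there {z} mv) = leaves-∷-cong z (LinearMove⇒leaves≡ mv)

  module _ {R : Fin m → Fin m → Set} (R? : Decidable R) where

    CyclicMove⇒cyclicLinks≡ : {xs ys : List (Fin m)} → CyclicMove ctr xs ys →
      cyclicLinks R? (leaves ctr xs) ≡ cyclicLinks R? (leaves ctr ys)
    CyclicMove⇒cyclicLinks≡ (linear mv) = cong (cyclicLinks R?) (LinearMove⇒leaves≡ mv)
    CyclicMove⇒cyclicLinks≡ (wrap {y = y} {zs} (inj₁ (refl , y≢ctr))) =
      trans (cong (cyclicLinks R?) (leaves-centre-∷-∷ʳ zs y≢ctr))
        (trans (sym (cyclicLinks-rotate R? y (leaves ctr zs)))
               (cong (cyclicLinks R?) (sym (leaves-∷-centre-∷ʳ zs y≢ctr))))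
    CyclicMove⇒cyclicLinks≡ (wrap {x = x} {zs = zs} (inj₂ (refl , x≢ctr))) =
      trans (cong (cyclicLinks R?) (leaves-∷-centre-∷ʳ zs x≢ctr))
        (trans (cyclicLinks-rotate R? x (leaves ctr zs))
               (cong (cyclicLinks R?) (sym (leaves-centre-∷-∷ʳ zs x≢ctr))))

    path⇒cyclicLinks≡ : {c : Fin m → ℕ} {σ τ : FSVertex n m c} →
      Star (FSAdj (CycleAdj n) (StarAdj m ctr) c) σ τ →
      cyclicLinks R? (leaves ctr (tabulate (proj₁ σ))) ≡ cyclicLinks R? (leaves ctr (tabulate (proj₁ τ)))
    path⇒cyclicLinks≡ ε = refl
    path⇒cyclicLinks≡ (step ◅ path) =
      trans (CyclicMove⇒cyclicLinks≡ (SwapStep⇒CyclicMove step)) (path⇒cyclicLinks≡ path)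

module _ {u₁ u₂ : Fin m} where

  Separated : List (Fin m) → Set
  Separated xs = Σ (Fin m) λ t → Σ (List (Fin m)) λ ts →
    xs ≡ t ∷ ts × t ≢ u₁ × final t ts ≢ u₂

  separated-long-ends : u₁ ≢ u₂ → (j₁ j₂ : ℕ) (rs : List (Fin m)) →
    Separated (replicate (suc j₂) u₂ ++ rs ++ replicate (suc j₁) u₁)
  separated-long-ends u₁≢u₂ j₁ j₂ rs = u₂ , _ , refl , u₁≢u₂ ∘ sym , final≢u₂
    where
    final≢u₂ : final u₂ (replicate j₂ u₂ ++ rs ++ u₁ ∷ replicate j₁ u₁) ≢ u₂
    final≢u₂ = subst (_≢ u₂)
      (sym (trans (cong (final u₂) (sym (++-assoc (replicate j₂ u₂) rs _)))
                  (final-++-∷ u₂ (replicate j₂ u₂ ++ rs) u₁ (replicate j₁ u₁))))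
      (final-All {P = _≢ u₂} u₁≢u₂ (replicate⁺ j₁ u₁≢u₂))

  separated-inner : u₁ ≢ u₂ → (k₁ k₂ : ℕ) {rs : List (Fin m)} → rs ≢ [] →
    All (λ r → r ≢ u₁ × r ≢ u₂) rs → Separated (replicate k₂ u₂ ++ rs ++ replicate k₁ u₁)
  separated-inner _ _ _ {[]} []≢[] _ = contradiction refl []≢[]
  separated-inner u₁≢u₂ k₁ zero {r ∷ _} _ ((r≢u₁ , r≢u₂) ∷ rs-leaves) =
    r , _ , refl , r≢u₁ ,
    final-All {P = _≢ u₂} r≢u₂ (++⁺ (All.map proj₂ rs-leaves) (replicate⁺ k₁ u₁≢u₂))
  separated-inner u₁≢u₂ k₁ (suc j₂) {r ∷ _} _ ((_ , r≢u₂) ∷ rs-leaves) =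
    u₂ , _ , refl , u₁≢u₂ ∘ sym ,
    subst (_≢ u₂) (sym (final-++-∷ u₂ (replicate j₂ u₂) r _))
      (final-All {P = _≢ u₂} r≢u₂ (++⁺ (All.map proj₂ rs-leaves) (replicate⁺ k₁ u₁≢u₂)))

module Obstruction
  {ctr u₁ u₂ : Fin m} (u₁≢ctr : u₁ ≢ ctr) (u₂≢ctr : u₂ ≢ ctr) (u₁≢u₂ : u₁ ≢ u₂)
  {c : Fin m → ℕ} {k₁ k₂ : ℕ} (c-u₁ : c u₁ ≡ suc k₁) (c-u₂ : c u₂ ≡ suc k₂) where

  OtherLeaf : Fin m → Set
  OtherLeaf y = y ≢ ctr × y ≢ u₁ × y ≢ u₂

  otherLeaf? : ∀ y → Dec (OtherLeaf y)
  otherLeaf? y = ¬? (y ≟ ctr) ×-dec ¬? (y ≟ u₁) ×-dec ¬? (y ≟ u₂)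

  rest : List (Fin m)
  rest = blocks c (filter otherLeaf? (allFin m))

  rest-others : All OtherLeaf rest
  rest-others = blocks-All c (all-filter otherLeaf? (allFin m))

  count-rest : (y : Fin m) → OtherLeaf y → count y rest ≡ c y
  count-rest y other = begin
    count y rest
      ≡⟨ count-blocks c y (filter otherLeaf? (allFin m)) ⟩
    c y * count y (filter otherLeaf? (allFin m))
      ≡⟨ cong (c y *_) (trans (count-filter otherLeaf? other (allFin m)) (count-allFin y)) ⟩
    c y * 1
      ≡⟨ *-identityʳ (c y) ⟩
    c y ∎
    where open ≡-Reasoning

  middle : List (Fin m)
  middle = replicate k₂ u₂ ++ rest ++ replicate k₁ u₁

  word₁₂ word₂₁ : List (Fin m)
  word₁₂ = u₁ ∷ u₂ ∷ middle ++ replicate (c ctr) ctr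
  word₂₁ = u₂ ∷ u₁ ∷ middle ++ replicate (c ctr) ctr

  count-word₁₂ : {y : Fin m} {a b p q r s : ℕ} →
    count y [ u₁ ] ≡ a → count y [ u₂ ] ≡ b → count y (replicate k₂ u₂) ≡ p →
    count y rest ≡ q → count y (replicate k₁ u₁) ≡ r → count y (replicate (c ctr) ctr) ≡ s →
    count y word₁₂ ≡ a + (b + ((p + (q + r)) + s))
  count-word₁₂ ea eb ep eq er es =
    trans (count-++ [ u₁ ] _) (cong₂ _+_ ea (trans (count-++ [ u₂ ] _) (cong₂ _+_ eb
      (trans (count-++ middle _) (cong₂ _+_
        (trans (count-++ (replicate k₂ u₂) _) (cong₂ _+_ ep (trans (count-++ rest _) (cong₂ _+_ eq er))))
        es)))))

  word₁₂-counts : HasCounts c word₁₂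
  word₁₂-counts y with y ≟ ctr | y ≟ u₁ | y ≟ u₂
  ... | yes refl | _ | _ =
    count-word₁₂ {ctr} (count-∷-≢ [] u₁≢ctr) (count-∷-≢ [] u₂≢ctr)
      (count-replicate-≢ k₂ u₂≢ctr) (count-none (All.map proj₁ rest-others))
      (count-replicate-≢ k₁ u₁≢ctr) (count-replicate-≡ (c ctr))
  ... | no y≢ctr | yes refl | _ = trans
    (count-word₁₂ {u₁} (count-∷-≡ {y = u₁} []) (count-∷-≢ [] (u₁≢u₂ ∘ sym))
      (count-replicate-≢ k₂ (u₁≢u₂ ∘ sym)) (count-none (All.map (proj₁ ∘ proj₂) rest-others))
      (count-replicate-≡ k₁) (count-replicate-≢ (c ctr) (y≢ctr ∘ sym)))
    (trans (cong suc (+-identityʳ k₁)) (sym c-u₁))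
  ... | no y≢ctr | no _ | yes refl = trans
    (count-word₁₂ {u₂} (count-∷-≢ [] u₁≢u₂) (count-∷-≡ {y = u₂} [])
      (count-replicate-≡ k₂) (count-none (All.map (proj₂ ∘ proj₂) rest-others))
      (count-replicate-≢ k₁ u₁≢u₂) (count-replicate-≢ (c ctr) (y≢ctr ∘ sym)))
    (trans (cong suc (trans (+-identityʳ _) (+-identityʳ k₂))) (sym c-u₂))
  ... | no y≢ctr | no y≢u₁ | no y≢u₂ = trans
    (count-word₁₂ {y} (count-∷-≢ [] (y≢u₁ ∘ sym)) (count-∷-≢ [] (y≢u₂ ∘ sym))
      (count-replicate-≢ k₂ (y≢u₂ ∘ sym)) (count-rest y (y≢ctr , y≢u₁ , y≢u₂))
      (count-replicate-≢ k₁ (y≢u₁ ∘ sym)) (count-replicate-≢ (c ctr) (y≢ctr ∘ sym)))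
    (trans (+-identityʳ _) (+-identityʳ (c y)))

  word₂₁-counts : HasCounts c word₂₁
  word₂₁-counts y = trans (count-↭ y (↭-swap u₂ u₁ ↭-refl)) (word₁₂-counts y)

  leaves-word : {x y : Fin m} → x ≢ ctr → y ≢ ctr →
    leaves ctr (x ∷ y ∷ middle ++ replicate (c ctr) ctr) ≡ x ∷ y ∷ middle
  leaves-word x≢ctr y≢ctr = leaves-++-centres (c ctr) (x≢ctr ∷ y≢ctr ∷ middle-leaves)
    where
    middle-leaves : All (_≢ ctr) middle
    middle-leaves =
      ++⁺ (replicate⁺ k₂ u₂≢ctr) (++⁺ (All.map proj₁ rest-others) (replicate⁺ k₁ u₁≢ctr))

  separated-middle-disconnected : Separated {u₁ = u₁} {u₂} middle →
    ¬ FSConnected (CycleAdj (sumFin c)) (StarAdj m ctr) c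
  separated-middle-disconnected (t , ts , middle≡t∷ts , t≢u₁ , final≢u₂) connected = 1+n≢n (begin
    suc (cyclicLinks consecutive? (u₁ ∷ u₂ ∷ t ∷ ts))
      ≡⟨ sym (cyclicLinks-swap-front (u₁≢u₂ ∘ sym) t ts t≢u₁ final≢u₂) ⟩
    cyclicLinks consecutive? (u₂ ∷ u₁ ∷ t ∷ ts)
      ≡⟨ cong (cyclicLinks consecutive?) (sym (leaves-of σ₂₁ u₂≢ctr u₁≢ctr)) ⟩
    cyclicLinks consecutive? (leaves ctr (tabulate (proj₁ (proj₁ σ₂₁))))
      ≡⟨ sym (path⇒cyclicLinks≡ consecutive? (connected (proj₁ σ₁₂) (proj₁ σ₂₁))) ⟩
    cyclicLinks consecutive? (leaves ctr (tabulate (proj₁ (proj₁ σ₁₂))))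
      ≡⟨ cong (cyclicLinks consecutive?) (leaves-of σ₁₂ u₁≢ctr u₂≢ctr) ⟩
    cyclicLinks consecutive? (u₁ ∷ u₂ ∷ t ∷ ts) ∎)
    where
    open ≡-Reasoning
    σ₁₂ = list-vertex-sumFin word₁₂ word₁₂-counts
    σ₂₁ = list-vertex-sumFin word₂₁ word₂₁-counts
    leaves-of : {x y : Fin m} (σ : Σ (FSVertex (sumFin c) m c) λ σ →
                  tabulate (proj₁ σ) ≡ x ∷ y ∷ middle ++ replicate (c ctr) ctr) →
      x ≢ ctr → y ≢ ctr → leaves ctr (tabulate (proj₁ (proj₁ σ))) ≡ x ∷ y ∷ t ∷ ts
    leaves-of {x} {y} (_ , tabulate-σ) x≢ctr y≢ctr = trans (cong (leaves ctr) tabulate-σ)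
      (trans (leaves-word x≢ctr y≢ctr) (cong (λ w → x ∷ y ∷ w) middle≡t∷ts))

two-long-leaves-disconnected : {ctr u₁ u₂ : Fin m} → u₁ ≢ ctr → u₂ ≢ ctr → u₁ ≢ u₂ →
  {c : Fin m → ℕ} → 2 ≤ c u₁ → 2 ≤ c u₂ → ¬ FSConnected (CycleAdj (sumFin c)) (StarAdj m ctr) c
two-long-leaves-disconnected u₁≢ctr u₂≢ctr u₁≢u₂ 2≤c-u₁ 2≤c-u₂
  with j₁ , c-u₁ ← m≤n⇒∃[o]m+o≡n 2≤c-u₁
     | j₂ , c-u₂ ← m≤n⇒∃[o]m+o≡n 2≤c-u₂ =
  separated-middle-disconnected (separated-long-ends u₁≢u₂ j₁ j₂ rest)
  where open Obstruction u₁≢ctr u₂≢ctr u₁≢u₂ (sym c-u₁) (sym c-u₂)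

three-leaves-disconnected : {ctr u₁ u₂ w : Fin m} → u₁ ≢ ctr → u₂ ≢ ctr → u₁ ≢ u₂ →
  w ≢ ctr → w ≢ u₁ → w ≢ u₂ → {c : Fin m → ℕ} → (∀ y → 1 ≤ c y) →
  ¬ FSConnected (CycleAdj (sumFin c)) (StarAdj m ctr) c
three-leaves-disconnected {u₁ = u₁} {u₂} {w} u₁≢ctr u₂≢ctr u₁≢u₂ w≢ctr w≢u₁ w≢u₂ positive
  with k₁ , c-u₁ ← m≤n⇒∃[o]m+o≡n (positive u₁)
     | k₂ , c-u₂ ← m≤n⇒∃[o]m+o≡n (positive u₂) =
  separated-middle-disconnected (separated-inner u₁≢u₂ k₁ k₂ rest≢[] (All.map proj₂ rest-others))
  where
  open Obstruction u₁≢ctr u₂≢ctr u₁≢u₂ (sym c-u₁) (sym c-u₂)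
  rest≢[] : rest ≢ []
  rest≢[] rest≡[] with () ← subst (λ xs → 1 ≤ count w xs) rest≡[]
                              (subst (1 ≤_) (sym (count-rest w (w≢ctr , w≢u₁ , w≢u₂))) (positive w))

-- Normal forms when every leaf but one is the same

module _ {ctr : Fin m} where

  private
    infix 4 _⟶*_
    _⟶*_ : List (Fin m) → List (Fin m) → Set
    _⟶*_ = Star (CyclicMove ctr)

  linear-moves : {xs ys : List (Fin m)} → Star (LinearMove ctr) xs ys → xs ⟶* ys
  linear-moves = gmap id linear

  prefix-moves : (ps : List (Fin m)) {xs ys : List (Fin m)} → Star (LinearMove ctr) xs ys →
    Star (LinearMove ctr) (ps ++ xs) (ps ++ ys)
  prefix-moves [] mvs = mvs
  prefix-moves (p ∷ ps) mvs = gmap (p ∷_) there (prefix-moves ps mvs)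

  pass-right : {a : Fin m} {ws : List (Fin m)} (zs : List (Fin m)) → All (StarAdj m ctr a) ws →
    Star (LinearMove ctr) (a ∷ ws ++ zs) (ws ++ a ∷ zs)
  pass-right zs [] = ε
  pass-right {ws = w ∷ _} zs (adj ∷ adjs) = here adj ◅ prefix-moves [ w ] (pass-right zs adjs)

  centre-adjacent : {ws : List (Fin m)} → All (_≢ ctr) ws → All (StarAdj m ctr ctr) ws
  centre-adjacent = All.map (λ w≢ctr → inj₁ (refl , w≢ctr))

  pack : (xs : List (Fin m)) → Σ (List (Fin m)) λ ws → Σ ℕ λ j →
    All (_≢ ctr) ws × Star (LinearMove ctr) xs (ws ++ replicate j ctr)
  pack [] = [] , 0 , [] , ε
  pack (x ∷ xs) with pack xs | x ≟ ctr
  ... | ws , j , ws-leaves , packing | no x≢ctr =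
    x ∷ ws , j , x≢ctr ∷ ws-leaves , prefix-moves [ x ] packing
  ... | ws , j , ws-leaves , packing | yes refl =
    ws , suc j , ws-leaves ,
    (prefix-moves [ ctr ] packing ◅◅ pass-right (replicate j ctr) (centre-adjacent ws-leaves))

  rotate-leaf : {w : Fin m} {ws : List (Fin m)} (j : ℕ) → w ≢ ctr → All (_≢ ctr) ws →
    (w ∷ ws) ++ replicate (suc j) ctr ⟶* (ws ++ [ w ]) ++ replicate (suc j) ctr
  rotate-leaf {w} {ws} j w≢ctr ws-leaves = begin
    w ∷ ws ++ replicate (suc j) ctr
      ≡⟨ cong (w ∷_) (trans (cong (ws ++_) (replicate-∷ʳ j ctr)) (sym (++-assoc ws _ _))) ⟩
    w ∷ (ws ++ replicate j ctr) ++ [ ctr ]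
      ⟶⟨ wrap (inj₂ (refl , w≢ctr)) ⟩
    ctr ∷ (ws ++ replicate j ctr) ++ [ w ]
      ≡⟨ cong (ctr ∷_) (++-assoc ws _ _) ⟩
    ctr ∷ ws ++ replicate j ctr ++ [ w ]
      ⟶*⟨ linear-moves (pass-right _ (centre-adjacent ws-leaves)) ⟩
    ws ++ replicate (suc j) ctr ++ [ w ]
      ⟶*⟨ linear-moves (prefix-moves ws (reverse LinearMove-sym
                        (pass-right [] (replicate⁺ (suc j) (inj₂ (refl , w≢ctr)))))) ⟩
    ws ++ w ∷ replicate (suc j) ctr ++ []
      ≡⟨ trans (cong (λ zs → ws ++ w ∷ zs) (++-identityʳ _)) (sym (++-assoc ws [ w ] _)) ⟩
    (ws ++ [ w ]) ++ replicate (suc j) ctr ∎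
    where open StarReasoning (CyclicMove ctr)

  rotate : {us vs : List (Fin m)} (j : ℕ) → All (_≢ ctr) us → All (_≢ ctr) vs →
    (us ++ vs) ++ replicate (suc j) ctr ⟶* (vs ++ us) ++ replicate (suc j) ctr
  rotate {vs = vs} j [] _ =
    subst (λ zs → vs ++ replicate (suc j) ctr ⟶* zs ++ replicate (suc j) ctr) (sym (++-identityʳ vs)) ε
  rotate {u ∷ us} {vs} j (u≢ctr ∷ us-leaves) vs-leaves = begin
    (u ∷ us ++ vs) ++ replicate (suc j) ctr
      ⟶*⟨ rotate-leaf j u≢ctr (++⁺ us-leaves vs-leaves) ⟩
    ((us ++ vs) ++ [ u ]) ++ replicate (suc j) ctr
      ≡⟨ cong (_++ replicate (suc j) ctr) (++-assoc us vs [ u ]) ⟩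
    (us ++ vs ++ [ u ]) ++ replicate (suc j) ctr
      ⟶*⟨ rotate j us-leaves (++⁺ vs-leaves (u≢ctr ∷ [])) ⟩
    ((vs ++ [ u ]) ++ us) ++ replicate (suc j) ctr
      ≡⟨ cong (_++ replicate (suc j) ctr) (++-assoc vs [ u ] us) ⟩
    (vs ++ u ∷ us) ++ replicate (suc j) ctr ∎
    where open StarReasoning (CyclicMove ctr)

module TwoLeaves {ctr ℓ b : Fin m} (ℓ≢ctr : ℓ ≢ ctr) (b≢ctr : b ≢ ctr) (b≢ℓ : b ≢ ℓ)
  (leaf-is-b : ∀ x → x ≢ ctr → x ≢ ℓ → x ≡ b)
  {c : Fin m → ℕ} (c-ℓ : c ℓ ≡ 1) {j : ℕ} (c-ctr : c ctr ≡ suc j) where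

  normal-word : List (Fin m)
  normal-word = ℓ ∷ replicate (c b) b ++ replicate (suc j) ctr

  normal-word-unique : (zs : List (Fin m)) (k : ℕ) → All (_≡ b) zs →
    HasCounts c (ℓ ∷ zs ++ replicate k ctr) → ℓ ∷ zs ++ replicate k ctr ≡ normal-word
  normal-word-unique zs k zs≡b counts =
    cong (ℓ ∷_) (cong₂ _++_ (trans (All≡⇒replicate zs≡b) (cong (λ i → replicate i b) count-b))
                            (cong (λ i → replicate i ctr) count-ctr))
    where
    zs-leaves : All (_≢ ctr) zs
    zs-leaves = All.map (λ z≡b z≡ctr → b≢ctr (trans (sym z≡b) z≡ctr)) zs≡b
    count-b : count b zs ≡ c b
    count-b = trans (sym (trans (count-∷-≢ _ (b≢ℓ ∘ sym)) (trans (count-++ zs _)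
                (trans (cong (count b zs +_) (count-replicate-≢ k (b≢ctr ∘ sym))) (+-identityʳ _)))))
              (counts b)
    count-ctr : k ≡ suc j
    count-ctr = trans (sym (trans (count-∷-≢ _ ℓ≢ctr) (trans (count-++ zs _)
                  (cong₂ _+_ (count-none zs-leaves) (count-replicate-≡ k)))))
                (trans (counts ctr) c-ctr)

  packed-to-normal : (ws : List (Fin m)) (k : ℕ) → All (_≢ ctr) ws →
    HasCounts c (ws ++ replicate k ctr) → Star (CyclicMove ctr) (ws ++ replicate k ctr) normal-word
  packed-to-normal ws zero ws-leaves counts
    with () ← trans (sym (trans (counts ctr) c-ctr))
                    (trans (count-++ ws []) (cong (_+ 0) (count-none ws-leaves)))
  packed-to-normal ws (suc k) ws-leaves counts with count≡1⇒split ws count-ℓ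
    where
    count-ℓ : count ℓ ws ≡ 1
    count-ℓ = trans (sym (trans (count-++ ws _)
                (trans (cong (count ℓ ws +_) (count-replicate-≢ (suc k) (ℓ≢ctr ∘ sym)))
                       (+-identityʳ _))))
              (trans (counts ℓ) c-ℓ)
  ... | us , vs , refl , us-no-ℓ , vs-no-ℓ =
    rotated ◅◅ subst (Star (CyclicMove ctr) _)
                 (normal-word-unique (vs ++ us) (suc k) vs++us≡b (moves-preserve-counts rotated counts)) ε
    where
    ℓ∷vs-leaves = ++⁻ʳ us ws-leaves
    rotated = rotate k (++⁻ˡ us ws-leaves) ℓ∷vs-leaves
    vs++us≡b : All (_≡ b) (vs ++ us)
    vs++us≡b = All.zipWith (λ (x≢ctr , x≢ℓ) → leaf-is-b _ x≢ctr x≢ℓ)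
                 (++⁺ (All.tail ℓ∷vs-leaves) (++⁻ˡ us ws-leaves) , ++⁺ vs-no-ℓ us-no-ℓ)

  to-normal : (xs : List (Fin m)) → HasCounts c xs → Star (CyclicMove ctr) xs normal-word
  to-normal xs counts with pack xs
  ... | ws , k , ws-leaves , packing =
    linear-moves packing ◅◅
    packed-to-normal ws k ws-leaves (moves-preserve-counts (linear-moves packing) counts)

  connected : FSConnected (CycleAdj (sumFin c)) (StarAdj m ctr) c
  connected = common-word⇒connected leave-normal-word (λ σ → to-normal _ (vertex-counts σ))
    where
    centres-moved : List (Fin m)
    centres-moved = ctr ∷ (replicate (c b) b ++ replicate j ctr) ++ [ ℓ ]
    leave-normal-word : CyclicMove ctr normal-word centres-moved
    leave-normal-word = subst (λ w → CyclicMove ctr w centres-moved)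
      (cong (ℓ ∷_) (trans (++-assoc (replicate (c b) b) _ _)
                          (cong (replicate (c b) b ++_) (sym (replicate-∷ʳ j ctr)))))
      (wrap (inj₂ (refl , ℓ≢ctr)))

Fin2-≢⇒opposite : {i j : Fin 2} → i ≢ j → i ≡ opposite j
Fin2-≢⇒opposite {zero} {zero} 0≢0 = contradiction refl 0≢0
Fin2-≢⇒opposite {zero} {suc zero} _ = refl
Fin2-≢⇒opposite {suc zero} {zero} _ = refl
Fin2-≢⇒opposite {suc zero} {suc zero} 1≢1 = contradiction refl 1≢1

Fin2-opposite-≢ : (i : Fin 2) → opposite i ≢ i
Fin2-opposite-≢ zero ()
Fin2-opposite-≢ (suc zero) ()

module _ {ctr ℓ : Fin 3} (ℓ≢ctr : ℓ ≢ ctr) where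

  other-leaf : Fin 3
  other-leaf = punchIn ctr (opposite (punchOut (ℓ≢ctr ∘ sym)))

  other-leaf≢ctr : other-leaf ≢ ctr
  other-leaf≢ctr = punchInᵢ≢i ctr _

  other-leaf≢ℓ : other-leaf ≢ ℓ
  other-leaf≢ℓ other-leaf≡ℓ = Fin2-opposite-≢ (punchOut (ℓ≢ctr ∘ sym))
    (punchIn-injective ctr _ _ (trans other-leaf≡ℓ (sym (punchIn-punchOut (ℓ≢ctr ∘ sym)))))

  ≡other-leaf : (x : Fin 3) → x ≢ ctr → x ≢ ℓ → x ≡ other-leaf
  ≡other-leaf x x≢ctr x≢ℓ = trans (sym (punchIn-punchOut (x≢ctr ∘ sym)))
    (cong (punchIn ctr)
      (Fin2-≢⇒opposite (x≢ℓ ∘ punchOut-injective (x≢ctr ∘ sym) (ℓ≢ctr ∘ sym))))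

connected⇒short-leaf : (m : ℕ) → 2 < m → (ctr : Fin m) (c : Fin m → ℕ) → (∀ y → 1 ≤ c y) →
  FSConnected (CycleAdj (sumFin c)) (StarAdj m ctr) c →
  (m ≡ 3) × Σ (Fin m) (λ ℓ → (ℓ ≢ ctr) × (c ℓ ≡ 1))
connected⇒short-leaf (suc zero) (s≤s ())
connected⇒short-leaf (suc (suc zero)) (s≤s (s≤s ()))
connected⇒short-leaf (suc (suc (suc zero))) _ ctr c positive connected
  with c (punchIn ctr zero) ≟ℕ 1 | c (punchIn ctr (suc zero)) ≟ℕ 1
... | yes c-u₁ | _ = refl , punchIn ctr zero , punchInᵢ≢i ctr zero , c-u₁
... | no _ | yes c-u₂ = refl , punchIn ctr (suc zero) , punchInᵢ≢i ctr (suc zero) , c-u₂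
... | no c-u₁≢1 | no c-u₂≢1 = contradiction connected
  (two-long-leaves-disconnected (punchInᵢ≢i ctr zero) (punchInᵢ≢i ctr (suc zero))
    ((λ ()) ∘ punchIn-injective ctr zero (suc zero))
    (≤∧≢⇒< (positive _) (c-u₁≢1 ∘ sym)) (≤∧≢⇒< (positive _) (c-u₂≢1 ∘ sym)))
connected⇒short-leaf (suc (suc (suc (suc k)))) _ ctr c positive connected = contradiction connected
  (three-leaves-disconnected (punchInᵢ≢i ctr zero) (punchInᵢ≢i ctr (suc zero))
    ((λ ()) ∘ punchIn-injective ctr zero (suc zero)) (punchInᵢ≢i ctr (suc (suc zero)))
    ((λ ()) ∘ punchIn-injective ctr _ zero) ((λ ()) ∘ punchIn-injective ctr _ (suc zero)) positive)

short-leaf⇒connected : (m : ℕ) (ctr : Fin m) (c : Fin m → ℕ) → 1 ≤ c ctr →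
  (m ≡ 3) × Σ (Fin m) (λ ℓ → (ℓ ≢ ctr) × (c ℓ ≡ 1)) →
  FSConnected (CycleAdj (sumFin c)) (StarAdj m ctr) c
short-leaf⇒connected _ ctr c 1≤c-ctr (refl , ℓ , ℓ≢ctr , c-ℓ)
  with j , c-ctr ← m≤n⇒∃[o]m+o≡n 1≤c-ctr =
  TwoLeaves.connected ℓ≢ctr (other-leaf≢ctr ℓ≢ctr) (other-leaf≢ℓ ℓ≢ctr) (≡other-leaf ℓ≢ctr)
    c-ℓ (sym c-ctr)

-- The argument only needs the centre to occur at all.
proposition4p4 : (m : ℕ) → 2 < m → (ctr : Fin m) → (c : Fin m → ℕ) →
    (∀ y → 1 ≤ c y) → 2 ≤ c ctr →
    FSConnected (CycleAdj (sumFin c)) (StarAdj m ctr) c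
      ⇔ ((m ≡ 3) × Σ (Fin m) (λ ℓ → (ℓ ≢ ctr) × (c ℓ ≡ 1)))
proposition4p4 m 2<m ctr c positive _ =
  mk⇔ (connected⇒short-leaf m 2<m ctr c positive) (short-leaf⇒connected m ctr c (positive ctr))
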